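{- Let $v\ge5$ and $m=\frac12\binom v2$. For all integers $e$ with $v\le e\le m-0.55v$, $S(v,e)>C(v,e)$.
   Context: For $0\le e\le\binom v2$ write $e=\binom{k+1}2-j$ with integers $1\le j\le k$; the quasi-complete graph on $v$ vertices with $e$ edges consists of a complete graph on vertices $1,\dots,k$, a vertex $k+1$ adjacent to vertices $1,\dots,k-j$, and isolated vertices; $C(v,e)$ is its sum of squared degrees. The quasi-star graph on $v$ vertices with $e$ edges is the complement of the quasi-complete graph with $v$ vertices and $\binom v2-e$ edges; $S(v,e)$ is its sum of squared degrees. -}

module Defs where

open import Data.Nat using (ℕ; zero; suc; _+_; _*_; _∸_; _<ᵇ_; _≡ᵇ_)
open import Data.Nat.Combinatorics using (_C_)
open import Data.Bool using (Bool; true; false; _∧_; _∨_; not; if_then_else_)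
open import Data.Product using (_×_; _,_; proj₁; proj₂)
open import Data.Fin using (Fin; toℕ)
open import Data.Nat.ListAction using (sum)
open import Data.List using (List; map; filter; length; allFin)
open import Data.Nat.Properties using ()
open import Relation.Nullary.Decidable using (does)
open import Data.Bool.Properties using (T?)

-- The unique representation e = C(k+1,2) - j with 1 ≤ j ≤ k,
-- returned as the pair (k , j).  Computed incrementally:
-- 0 = C(2,2) - 1 gives (1,1); from e = C(k+1,2) - j,
-- e+1 = C(k+1,2) - (j-1) if j > 1, and e+1 = C(k+2,2) - (k+1) if j = 1.
rep : ℕ → ℕ × ℕ
rep zero = 1 , 1
rep (suc e) with rep e
... | k , suc zero = suc k , suc k
... | k , j        = k , j ∸ 1

-- Adjacency in the quasi-complete graph on vertices 0..v-1 (vertex i here is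
-- vertex i+1 of the paper): complete on {0..k-1}, vertex k adjacent to 0..k-j-1.
qcAdj : ℕ → ℕ → ℕ → ℕ → Bool
qcAdj k j x y =
  not (x ≡ᵇ y) ∧
  ( ((x <ᵇ k) ∧ (y <ᵇ k))
  ∨ ((x ≡ᵇ k) ∧ (y <ᵇ (k ∸ j)))
  ∨ ((y ≡ᵇ k) ∧ (x <ᵇ (k ∸ j))) )

quasiCompleteAdj : (v e : ℕ) → Fin v → Fin v → Bool
quasiCompleteAdj v e a b = qcAdj (proj₁ (rep e)) (proj₂ (rep e)) (toℕ a) (toℕ b)

quasiStarAdj : (v e : ℕ) → Fin v → Fin v → Bool
quasiStarAdj v e a b =
  not (toℕ a ≡ᵇ toℕ b) ∧ not (quasiCompleteAdj v ((v C 2) ∸ e) a b)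

degree : {v : ℕ} → (Fin v → Fin v → Bool) → Fin v → ℕ
degree {v} adj a = length (filter (λ b → T? (adj a b)) (allFin v))

sumSqDeg : {v : ℕ} → (Fin v → Fin v → Bool) → ℕ
sumSqDeg {v} adj = sum (map (λ a → degree adj a * degree adj a) (allFin v))

Csq : ℕ → ℕ → ℕ
Csq v e = sumSqDeg (quasiCompleteAdj v e)

Ssq : ℕ → ℕ → ℕ
Ssq v e = sumSqDeg (quasiStarAdj v e)

module Submission where

-- Write e = C(k,2) + a (0 ≤ a < k) for the quasi-complete graph, and
-- x = C(v,2) - e = C(L,2) + i (0 ≤ i < L) for the quasi-complete graph whose
-- complement is the quasi-star.  The quasi-complete graph with parameters
-- (k,a) has a vertices of degree k, k - a of degree k - 1, one of degree a
-- and v - 1 - k isolated vertices, and complementing replaces each degree d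
-- by v - 1 - d.  So C and S are explicit polynomials in (v,k,a,L,i), and the
-- theorem becomes a polynomial inequality subject to e + x = C(v,2).

open import Defs

module IntegerCertificates where

  open import Data.Nat using (zero; suc; z≤n; s≤s)
  open import Data.Nat.Properties using (1+n≢0; +-suc)
  open import Data.Integer using (ℤ; +_; -[1+_]; 0ℤ; 1ℤ; _+_; _-_; _*_; -_; _≤_; +≤+)
  open import Data.Integer.Properties
    using (+-mono-≤; pos-*; *-zeroʳ; +-identityʳ; +-injective; i≤j⇒0≤j-i; 0≤i-j⇒j≤i; i≡j⇒i-j≡0; *-monoˡ-≤-nonNeg)
  open import Data.Integer.Tactic.RingSolver using (solve-∀)
  open import Data.Sum using (_⊎_; inj₁; inj₂)
  open import Data.Empty using (⊥; ⊥-elim)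
  open import Relation.Binary.PropositionalEquality using (_≡_; refl; sym; trans; cong; subst; subst₂)

  -- Nonnegativity calculus: certificates are sums of products of
  -- quantities known to be nonnegative.

  NonNeg : ℤ → Set
  NonNeg x = 0ℤ ≤ x

  Neg : ℤ → Set
  Neg x = NonNeg (- x - 1ℤ)

  infixl 6 _⊕_
  infixl 7 _⊗_

  _⊕_ : ∀ {x y} → NonNeg x → NonNeg y → NonNeg (x + y)
  _⊕_ = +-mono-≤

  _⊗_ : ∀ {x y} → NonNeg x → NonNeg y → NonNeg (x * y)
  _⊗_ {+ m} {+ n} _ _ = subst NonNeg (pos-* m n) (+≤+ z≤n)

  #_ : ∀ n → NonNeg (+ n)
  # n = +≤+ z≤n

  square≥0 : ∀ x → NonNeg (x * x)
  square≥0 (+ n) = # n ⊗ # n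
  square≥0 -[1+ n ] = +≤+ z≤n

  neg⊗neg : ∀ {x y} → Neg x → Neg y → NonNeg (x * y)
  neg⊗neg { -[1+ m ]} { -[1+ n ]} _ _ = +≤+ z≤n
  neg⊗neg {+ zero} () _
  neg⊗neg {+ suc m} () _
  neg⊗neg { -[1+ m ]} {+ zero} _ ()
  neg⊗neg { -[1+ m ]} {+ suc n} _ ()

  nonneg-or-neg : ∀ x → NonNeg x ⊎ Neg x
  nonneg-or-neg (+ n) = inj₁ (# n)
  nonneg-or-neg -[1+ n ] = inj₂ (# n)

  zero-or-pos : ∀ x → NonNeg x → x ≡ 0ℤ ⊎ NonNeg (x - 1ℤ)
  zero-or-pos (+ zero) _ = inj₁ refl
  zero-or-pos (+ suc n) _ = inj₂ (# n)

  impossible : ∀ n {P} → NonNeg P → P + + suc n ≡ 0ℤ → ⊥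
  impossible n {+ m} _ eq = 1+n≢0 (trans (sym (+-suc m n)) (+-injective eq))

  positive : ∀ c n {X P} → NonNeg P → + suc c * X ≡ P + + suc n → 1ℤ ≤ X
  positive c n {+ zero} P≥0 eq = ⊥-elim (impossible n P≥0 (sym (trans (sym (*-zeroʳ (+ suc c))) eq)))
  positive c n {+ suc x} _ _ = +≤+ (s≤s z≤n)
  positive c n { -[1+ x ]} {+ m} _ ()

  -- Certificates hold modulo terms r * w whose factor r is known to vanish.
  vanish : ∀ {X Y} r w → r ≡ 0ℤ → X ≡ Y + r * w → X ≡ Y
  vanish {Y = Y} r w refl eq = trans eq (+-identityʳ Y)

  -- Sum of G(degree) over the vertices of the quasi-complete graph on v
  -- vertices with e = C(k,2) + a edges (0 ≤ a < k): a vertices of degree k,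
  -- k - a of degree k - 1, one of degree a and v - 1 - k isolated ones.
  degreeProfile : (ℤ → ℤ) → ℤ → ℤ → ℤ → ℤ
  degreeProfile G v k a = a * G k + (k - a) * G (k - 1ℤ) + G a + (v - 1ℤ - k) * G 0ℤ

  square : ℤ → ℤ
  square x = x * x

  twiceEdges : ℤ → ℤ → ℤ
  twiceEdges k a = k * (k - 1ℤ) + (+ 2) * a

  -- Notation, with
  -- e = C(k,2)+a, x = C(L,2)+i the edge numbers of the quasi-complete graph
  -- and of the complement of the quasi-star:
  --   α = v-k, β = v-L, d = L-k, w = k+L-v, T = a+i, p = i-a,
  --   σ = αβ - T, τ = T + 1 - α - β, Φ = dσ + pτ,
  --   ρ = v(v-1) - 2e - 2x  (which vanishes since e + x = C(v,2)),
  -- and the slacks a′ = k-1-a, i′ = L-1-i, α′ = v-1-k, β′ = v-1-L,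
  -- bot = 2e - 2v, top = 5v(v-1) - 20e - 11v of the hypotheses.

  -- S - C equals Φ modulo ρ.
  S-C≡Φ : ∀ (k a L i v : ℤ) →
    let α = v - k ; β = v - L ; d = L - k ; T = a + i ; p = i - a
        σ = α * β - T ; τ = T + 1ℤ - α - β ; Φ = d * σ + p * τ
        ρ = v * (v - 1ℤ) - (k * (k - 1ℤ) + (+ 2) * a + (L * (L - 1ℤ) + (+ 2) * i))
        C = a * (k * k) + (k - a) * ((k - 1ℤ) * (k - 1ℤ)) + a * a + (v - 1ℤ - k) * (0ℤ * 0ℤ)
        S = i * ((v - 1ℤ - L) * (v - 1ℤ - L)) + (L - i) * ((v - 1ℤ - (L - 1ℤ)) * (v - 1ℤ - (L - 1ℤ)))
            + (v - 1ℤ - i) * (v - 1ℤ - i) + (v - 1ℤ - L) * ((v - 1ℤ - 0ℤ) * (v - 1ℤ - 0ℤ))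
    in S - C ≡ Φ + ρ * ((+ 2) * k + α - L - 1ℤ)
  S-C≡Φ = solve-∀

  -- If L ≤ k then x - e = C(L,2) - C(k,2) + i - a < v, whereas the upper
  -- bound on e says 10(x - e) = 10C(v,2) - 20e ≥ 11v.
  refute-L≤k : ∀ (k a L i v : ℤ) →
    let d = L - k ; kl = - (d - 1ℤ) - 1ℤ
        e₂ = k * (k - 1ℤ) + (+ 2) * a ; ρ = v * (v - 1ℤ) - (e₂ + (L * (L - 1ℤ) + (+ 2) * i))
        a′ = k - (1ℤ + a) ; i′ = L - (1ℤ + i) ; α′ = v - (1ℤ + k) ; β′ = v - (1ℤ + L)
        top = (+ 5) * (v * (v - 1ℤ)) - ((+ 10) * e₂ + (+ 11) * v)
    in top + (+ 5) * kl * (a′ + a + i′ + i + 1ℤ) + (a′ + a) + α′ + (+ 10) * β′ + (+ 10) * i′ + (+ 10) * a + (+ 22)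
       ≡ 0ℤ + ρ * (+ 5)
  refute-L≤k = solve-∀

  -- If L = v - 1 the quasi-complete graph has fewer than v edges.
  refute-L≡v-1 : ∀ (k a L i v : ℤ) →
    let e₂ = k * (k - 1ℤ) + (+ 2) * a ; ρ = v * (v - 1ℤ) - (e₂ + (L * (L - 1ℤ) + (+ 2) * i))
        β′ = v - (1ℤ + L) ; bot = e₂ - (+ 2) * v
    in bot + (+ 2) * i + (+ 2) ≡ 0ℤ + β′ * ((+ 2) * v - (+ 3) - β′) + ρ * (- 1ℤ)
  refute-L≡v-1 = solve-∀

  -- If k + L ≤ v + 1 the two graphs cannot have C(v,2) edges together.
  refute-w≤1 : ∀ (k a L i v : ℤ) →
    let d = L - k ; w = k + L - v ; u = - (w - (+ 2)) - 1ℤ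
        e₂ = k * (k - 1ℤ) + (+ 2) * a ; ρ = v * (v - 1ℤ) - (e₂ + (L * (L - 1ℤ) + (+ 2) * i))
        a′ = k - (1ℤ + a) ; i′ = L - (1ℤ + i) ; α′ = v - (1ℤ + k) ; bot = e₂ - (+ 2) * v
    in u * ((+ 2) * a′ + (+ 2) * a + α′ + i′ + i + (+ 2)) + (+ 2) * bot + (+ 2) * (a′ + a + 1ℤ) * (d - 1ℤ)
         + (+ 6) * a′ + (+ 2) * i′ + (+ 4) * u + (+ 6)
       ≡ 0ℤ + ρ * 1ℤ
  refute-w≤1 = solve-∀

  -- σ = C(w,2) modulo ρ.
  2σ≡w[w-1] : ∀ (k a L i v : ℤ) →
    let α = v - k ; β = v - L ; w = k + L - v ; σ = α * β - (a + i)
        ρ = v * (v - 1ℤ) - (k * (k - 1ℤ) + (+ 2) * a + (L * (L - 1ℤ) + (+ 2) * i))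
    in (+ 2) * σ ≡ (w - (+ 2)) * (w - (+ 2) + (+ 3)) + (+ 2) + ρ * 1ℤ
  2σ≡w[w-1] = solve-∀

  Φ-split : ∀ (d σ p τ : ℤ) →
    1ℤ * (d * σ + p * τ) ≡ (d - 1ℤ) * (σ - 1ℤ) + (d - 1ℤ) + (σ - 1ℤ) + p * τ + 1ℤ
  Φ-split = solve-∀

  -- p ≥ 0 > τ and L ≥ k + 2:  4Φ = (2T - 2α + 1)² + 8a(-τ) + [4dαβ - (2α-1)²],
  -- and the bracket is 15 plus a polynomial in β - 2, d - 2 with nonnegative coefficients.
  4Φ-wide : ∀ (k a L i v : ℤ) →
    let α = v - k ; β = v - L ; d = L - k ; T = a + i ; p = i - a
        σ = α * β - T ; τ = T + 1ℤ - α - β ; Φ = d * σ + p * τ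
        t′ = - τ - 1ℤ ; b = v - (1ℤ + L) - 1ℤ ; c = d - 1ℤ - 1ℤ
    in (+ 4) * Φ ≡ ((+ 2) * T - (+ 2) * α + 1ℤ) * ((+ 2) * T - (+ 2) * α + 1ℤ) + (+ 8) * a * (t′ + 1ℤ)
         + ((+ 20) * b + (+ 4) * b * b + (+ 20) * c + (+ 24) * c * b + (+ 4) * c * b * b + (+ 4) * c * c + (+ 4) * c * c * b)
         + (+ 15)
  4Φ-wide = solve-∀

  -- p ≥ 0 > τ and L = k + 1:  Φ = (T-β)(T-β-1) + 2a(-τ), with T - β - 2 = (p - β - 2) + 2a.
  Φ-narrow : ∀ (k a L i v : ℤ) →
    let α = v - k ; β = v - L ; d = L - k ; T = a + i ; p = i - a
        σ = α * β - T ; τ = T + 1ℤ - α - β ; Φ = d * σ + p * τ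
        ρ = v * (v - 1ℤ) - (k * (k - 1ℤ) + (+ 2) * a + (L * (L - 1ℤ) + (+ 2) * i))
        t′ = - τ - 1ℤ ; s = p - β - (+ 2)
    in 1ℤ * Φ ≡ (s + (+ 2) * a) * (s + (+ 2) * a + (+ 3)) + (+ 2) * a * (t′ + 1ℤ) + (+ 2)
         + (d - 1ℤ) * (- k * α + k - α * L + (+ 2) * α + L * L - (+ 2) * L) + ρ * (d - 1ℤ)
  Φ-narrow = solve-∀

  -- For L = k + 1 the upper bound on e forces p ≥ β + 2.
  refute-narrow-small-p : ∀ (k a L i v : ℤ) →
    let β = v - L ; d = L - k ; p = i - a ; z = - (p - β - (+ 2)) - 1ℤ
        e₂ = k * (k - 1ℤ) + (+ 2) * a ; ρ = v * (v - 1ℤ) - (e₂ + (L * (L - 1ℤ) + (+ 2) * i))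
        a′ = k - (1ℤ + a) ; β′ = v - (1ℤ + L)
        top = (+ 5) * (v * (v - 1ℤ)) - ((+ 10) * e₂ + (+ 11) * v)
    in top + (+ 10) * z + a′ + a + β′ + (+ 3) ≡ 0ℤ + (d - 1ℤ) * ((+ 5) * k + (+ 5) * L - (+ 11)) + ρ * (+ 5)
  refute-narrow-small-p = solve-∀

  -- For L = k + 1 the upper bound on e also forces p ≥ 0.
  refute-narrow-negative-p : ∀ (k a L i v : ℤ) →
    let d = L - k ; q′ = - (i - a) - 1ℤ
        e₂ = k * (k - 1ℤ) + (+ 2) * a ; ρ = v * (v - 1ℤ) - (e₂ + (L * (L - 1ℤ) + (+ 2) * i))
        a′ = k - (1ℤ + a) ; α′ = v - (1ℤ + k)
        top = (+ 5) * (v * (v - 1ℤ)) - ((+ 10) * e₂ + (+ 11) * v)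
    in top + (+ 10) * q′ + a′ + a + (+ 11) * α′ + (+ 22) ≡ 0ℤ + (d - 1ℤ) * ((+ 5) * k + (+ 5) * L) + ρ * (+ 5)
  refute-narrow-negative-p = solve-∀

  -- p < 0 ≤ τ and L = k + 2: a certificate using the upper bound on e.
  100Φ-gap2 : ∀ (k a L i v : ℤ) →
    let α = v - k ; β = v - L ; d = L - k ; w = k + L - v ; T = a + i ; p = i - a
        σ = α * β - T ; τ = T + 1ℤ - α - β ; Φ = d * σ + p * τ
        e₂ = k * (k - 1ℤ) + (+ 2) * a ; ρ = v * (v - 1ℤ) - (e₂ + (L * (L - 1ℤ) + (+ 2) * i))
        a′ = k - (1ℤ + a) ; β′ = v - (1ℤ + L) ; q′ = - p - 1ℤ
        top = (+ 5) * (v * (v - 1ℤ)) - ((+ 10) * e₂ + (+ 11) * v)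
        s = w - (+ 2) ; W = top + (+ 2) * (β′ - 1ℤ)
    in (+ 100) * Φ ≡ s * (s + (+ 206)) + ((+ 2) * s + (+ 6)) * W + W * W + (+ 200) * (q′ + 1ℤ) * a′ + (+ 184)
         + (d - 1ℤ - 1ℤ) * ((+ 25) * k * k * k - (+ 100) * k * k * α + (+ 25) * k * k * L - (+ 10) * k * k
             + (+ 200) * k * a - (+ 50) * k * α * α - (+ 100) * k * α * L + (+ 170) * k * α + (+ 25) * k * L * L
             - (+ 50) * k * L + (+ 66) * k + (+ 200) * a * L - (+ 40) * a - (+ 50) * α * α * L + (+ 60) * α * α
             + (+ 50) * α * L - (+ 80) * α + (+ 25) * L * L * L + (+ 74) * L - (+ 108))
         + ρ * (- (+ 50) * k * α - (+ 100) * k + (+ 150) * a - (+ 25) * α * α + (+ 125) * α + (+ 25) * L * L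
             - (+ 25) * L - (+ 50) * i + (+ 50))
  100Φ-gap2 = solve-∀

  -- p < 0 ≤ τ and L ≥ k + 3: a certificate not needing the bounds on e.
  8Φ-gap3 : ∀ (k a L i v : ℤ) →
    let α = v - k ; β = v - L ; d = L - k ; T = a + i ; p = i - a
        σ = α * β - T ; τ = T + 1ℤ - α - β ; Φ = d * σ + p * τ
        ρ = v * (v - 1ℤ) - (k * (k - 1ℤ) + (+ 2) * a + (L * (L - 1ℤ) + (+ 2) * i))
        a′ = k - (1ℤ + a) ; q′ = - p - 1ℤ
        c = d - 1ℤ - 1ℤ - 1ℤ ; g = τ + (q′ + 1ℤ) + (+ 2) * a′
    in (+ 8) * Φ ≡ c * (g + c + (+ 2)) * (g + c + (+ 4)) + g * g + (+ 6) * g * (c + (+ 3)) + (+ 3) * c * (c + (+ 6))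
         + (+ 2) * ((g - (+ 2) * τ) * (g - (+ 2) * τ)) + (+ 16) * τ * a′ + (+ 24) + ρ * ((+ 4) * d)
  8Φ-gap3 = solve-∀

  gap⇒< : ∀ {x y} → 1ℤ ≤ y - x → 1ℤ + x ≤ y
  gap⇒< {x} {y} h = 0≤i-j⇒j≤i (subst NonNeg (shift y x) (i≤j⇒0≤j-i h))
    where
    shift : ∀ y x → y - x - 1ℤ ≡ y - (1ℤ + x)
    shift = solve-∀

  -- The arithmetic heart of the theorem: under the hypotheses of Lemma 7,
  -- written for the parameters (k,a) of the quasi-complete graph and (L,i) of
  -- the complement of the quasi-star, S(v,e) > C(v,e).
  module Comparison (k a L i v : ℤ)
    (a≥0 : 0ℤ ≤ a) (a<k : 1ℤ + a ≤ k) (i≥0 : 0ℤ ≤ i) (i<L : 1ℤ + i ≤ L)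
    (k<v : 1ℤ + k ≤ v) (L<v : 1ℤ + L ≤ v)
    (edges : twiceEdges k a + twiceEdges L i ≡ v * (v - 1ℤ))
    (v≤e : (+ 2) * v ≤ twiceEdges k a)
    (upper : (+ 10) * twiceEdges k a + (+ 11) * v ≤ (+ 5) * (v * (v - 1ℤ)))
    where

    ρ α β d w T p σ τ Φ : ℤ
    ρ = v * (v - 1ℤ) - (twiceEdges k a + twiceEdges L i)
    α = v - k
    β = v - L
    d = L - k
    w = k + L - v
    T = a + i
    p = i - a
    σ = α * β - T
    τ = T + 1ℤ - α - β
    Φ = d * σ + p * τ

    ρ≡0 : ρ ≡ 0ℤ
    ρ≡0 = i≡j⇒i-j≡0 (sym edges)

    a′≥0 : NonNeg (k - (1ℤ + a))
    a′≥0 = i≤j⇒0≤j-i a<k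
    i′≥0 : NonNeg (L - (1ℤ + i))
    i′≥0 = i≤j⇒0≤j-i i<L
    α′≥0 : NonNeg (v - (1ℤ + k))
    α′≥0 = i≤j⇒0≤j-i k<v
    β′≥0 : NonNeg (v - (1ℤ + L))
    β′≥0 = i≤j⇒0≤j-i L<v
    bot≥0 : NonNeg (twiceEdges k a - (+ 2) * v)
    bot≥0 = i≤j⇒0≤j-i v≤e
    top≥0 : NonNeg ((+ 5) * (v * (v - 1ℤ)) - ((+ 10) * twiceEdges k a + (+ 11) * v))
    top≥0 = i≤j⇒0≤j-i upper

    k<L : NonNeg (d - 1ℤ)
    k<L with nonneg-or-neg (d - 1ℤ)
    ... | inj₁ h = h
    ... | inj₂ k≥L = ⊥-elim (impossible 21
            (top≥0 ⊕ # 5 ⊗ k≥L ⊗ (a′≥0 ⊕ a≥0 ⊕ i′≥0 ⊕ i≥0 ⊕ # 1) ⊕ (a′≥0 ⊕ a≥0) ⊕ α′≥0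
               ⊕ # 10 ⊗ β′≥0 ⊕ # 10 ⊗ i′≥0 ⊕ # 10 ⊗ a≥0)
            (vanish ρ _ ρ≡0 (refute-L≤k k a L i v)))

    L<v-1 : NonNeg (v - (1ℤ + L) - 1ℤ)
    L<v-1 with zero-or-pos (v - (1ℤ + L)) β′≥0
    ... | inj₂ h = h
    ... | inj₁ β′≡0 = ⊥-elim (impossible 1 (bot≥0 ⊕ # 2 ⊗ i≥0)
            (vanish _ _ β′≡0 (vanish ρ _ ρ≡0 (refute-L≡v-1 k a L i v))))

    w≥2 : NonNeg (w - (+ 2))
    w≥2 with nonneg-or-neg (w - (+ 2))
    ... | inj₁ h = h
    ... | inj₂ w≤1 = ⊥-elim (impossible 5
            (w≤1 ⊗ (# 2 ⊗ a′≥0 ⊕ # 2 ⊗ a≥0 ⊕ α′≥0 ⊕ i′≥0 ⊕ i≥0 ⊕ # 2) ⊕ # 2 ⊗ bot≥0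
               ⊕ # 2 ⊗ (a′≥0 ⊕ a≥0 ⊕ # 1) ⊗ k<L ⊕ # 6 ⊗ a′≥0 ⊕ # 2 ⊗ i′≥0 ⊕ # 4 ⊗ w≤1)
            (vanish ρ _ ρ≡0 (refute-w≤1 k a L i v)))

    -- σ = C(w,2) ≥ 1
    σ≥1 : NonNeg (σ - 1ℤ)
    σ≥1 = i≤j⇒0≤j-i (positive 1 1 (w≥2 ⊗ (w≥2 ⊕ # 3)) (vanish ρ _ ρ≡0 (2σ≡w[w-1] k a L i v)))

    -- p and τ of equal sign: Φ ≥ dσ ≥ 1
    Φ-aligned : NonNeg (p * τ) → 1ℤ ≤ Φ
    Φ-aligned pτ≥0 = positive 0 0 (k<L ⊗ σ≥1 ⊕ k<L ⊕ σ≥1 ⊕ pτ≥0) (Φ-split d σ p τ)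

    -- p ≥ 0 > τ: for L ≥ k + 2 a sum-of-squares certificate; for L = k + 1,
    -- Φ = (T-β)(T-β-1) + 2a(-τ) where the upper bound on e gives T ≥ β + 2.
    Φ-p≥0>τ : NonNeg p → Neg τ → 1ℤ ≤ Φ
    Φ-p≥0>τ p≥0 τ<0 with zero-or-pos (d - 1ℤ) k<L
    ... | inj₂ c = positive 3 14
            (square≥0 ((+ 2) * T - (+ 2) * α + 1ℤ) ⊕ # 8 ⊗ a≥0 ⊗ (τ<0 ⊕ # 1)
               ⊕ (# 20 ⊗ b ⊕ # 4 ⊗ b ⊗ b ⊕ # 20 ⊗ c ⊕ # 24 ⊗ c ⊗ b ⊕ # 4 ⊗ c ⊗ b ⊗ b
                  ⊕ # 4 ⊗ c ⊗ c ⊕ # 4 ⊗ c ⊗ c ⊗ b))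
            (4Φ-wide k a L i v)
      where
      b : NonNeg (v - (1ℤ + L) - 1ℤ)
      b = L<v-1
    ... | inj₁ L≡k+1 with nonneg-or-neg (p - β - (+ 2))
    ...   | inj₁ s≥0 = positive 0 1 (s′ ⊗ (s′ ⊕ # 3) ⊕ # 2 ⊗ a≥0 ⊗ (τ<0 ⊕ # 1))
              (vanish _ _ L≡k+1 (vanish ρ _ ρ≡0 (Φ-narrow k a L i v)))
      where
      s′ : NonNeg (p - β - (+ 2) + (+ 2) * a)
      s′ = s≥0 ⊕ # 2 ⊗ a≥0
    ...   | inj₂ s<0 = ⊥-elim (impossible 2 (top≥0 ⊕ # 10 ⊗ s<0 ⊕ a′≥0 ⊕ a≥0 ⊕ β′≥0)
              (vanish _ _ L≡k+1 (vanish ρ _ ρ≡0 (refute-narrow-small-p k a L i v))))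

    -- p < 0 ≤ τ: L = k + 1 contradicts the upper bound on e; L = k + 2 and
    -- L ≥ k + 3 are closed by certificates.
    Φ-p<0≤τ : Neg p → NonNeg τ → 1ℤ ≤ Φ
    Φ-p<0≤τ p<0 τ≥0 with zero-or-pos (d - 1ℤ) k<L
    ... | inj₁ L≡k+1 = ⊥-elim (impossible 21 (top≥0 ⊕ # 10 ⊗ p<0 ⊕ a′≥0 ⊕ a≥0 ⊕ # 11 ⊗ α′≥0)
            (vanish _ _ L≡k+1 (vanish ρ _ ρ≡0 (refute-narrow-negative-p k a L i v))))
    ... | inj₂ L≥k+2 with zero-or-pos (d - 1ℤ - 1ℤ) L≥k+2
    ...   | inj₁ L≡k+2 = positive 99 183
              (w≥2 ⊗ (w≥2 ⊕ # 206) ⊕ (# 2 ⊗ w≥2 ⊕ # 6) ⊗ W ⊕ W ⊗ W ⊕ # 200 ⊗ (p<0 ⊕ # 1) ⊗ a′≥0)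
              (vanish _ _ L≡k+2 (vanish ρ _ ρ≡0 (100Φ-gap2 k a L i v)))
      where
      W : NonNeg ((+ 5) * (v * (v - 1ℤ)) - ((+ 10) * twiceEdges k a + (+ 11) * v) + (+ 2) * (v - (1ℤ + L) - 1ℤ))
      W = top≥0 ⊕ # 2 ⊗ L<v-1
    ...   | inj₂ c = positive 7 23
              (c ⊗ (g ⊕ c ⊕ # 2) ⊗ (g ⊕ c ⊕ # 4) ⊕ g ⊗ g ⊕ # 6 ⊗ g ⊗ (c ⊕ # 3) ⊕ # 3 ⊗ c ⊗ (c ⊕ # 6)
                 ⊕ # 2 ⊗ square≥0 (γ - (+ 2) * τ) ⊕ # 16 ⊗ τ≥0 ⊗ a′≥0)
              (vanish ρ _ ρ≡0 (8Φ-gap3 k a L i v))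
      where
      γ : ℤ
      γ = τ + (- p - 1ℤ + 1ℤ) + (+ 2) * (k - (1ℤ + a))
      g : NonNeg γ
      g = τ≥0 ⊕ (p<0 ⊕ # 1) ⊕ # 2 ⊗ a′≥0

    Φ≥1 : 1ℤ ≤ Φ
    Φ≥1 with nonneg-or-neg p | nonneg-or-neg τ
    ... | inj₁ p≥0 | inj₁ τ≥0 = Φ-aligned (_⊗_ {p} {τ} p≥0 τ≥0)
    ... | inj₂ p<0 | inj₂ τ<0 = Φ-aligned (neg⊗neg {p} {τ} p<0 τ<0)
    ... | inj₁ p≥0 | inj₂ τ<0 = Φ-p≥0>τ p≥0 τ<0
    ... | inj₂ p<0 | inj₁ τ≥0 = Φ-p<0≤τ p<0 τ≥0

    -- S - C = Φ ≥ 1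
    S>C : 1ℤ + degreeProfile square v k a ≤ degreeProfile (λ t → square (v - 1ℤ - t)) v L i
    S>C = gap⇒< (subst (1ℤ ≤_) (sym (vanish ρ _ ρ≡0 (S-C≡Φ k a L i v))) Φ≥1)

  clique-fits : ∀ k a {e N v} → 0ℤ ≤ a → twiceEdges k a ≡ (+ 2) * e → (+ 2) * N + v ≡ v * v →
    1ℤ + e ≤ N → 1ℤ ≤ v → 1ℤ + k ≤ v
  clique-fits k a {e} {N} {v} a≥0 edges choose2 e<N v≥1 with nonneg-or-neg (v - (1ℤ + k))
  ... | inj₁ k<v = 0≤i-j⇒j≤i k<v
  ... | inj₂ k≥v = ⊥-elim (impossible 1
          (# 2 ⊗ i≤j⇒0≤j-i e<N ⊕ k≥v ⊗ (k≥v ⊕ # 2 ⊗ i≤j⇒0≤j-i v≥1 ⊕ # 1) ⊕ # 2 ⊗ a≥0)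
          (vanish _ _ (i≡j⇒i-j≡0 choose2) (vanish _ _ (i≡j⇒i-j≡0 edges) (certificate k a e N v))))
    where
    -- k ≥ v would give 2e ≥ k(k-1) ≥ v(v-1) = 2N
    certificate : ∀ (k a e N v : ℤ) → let s = - (v - (1ℤ + k)) - 1ℤ in
      (+ 2) * (N - (1ℤ + e)) + s * (s + (+ 2) * (v - 1ℤ) + 1ℤ) + (+ 2) * a + (+ 2)
      ≡ 0ℤ + ((+ 2) * N + v - v * v) * 1ℤ + (k * (k - 1ℤ) + (+ 2) * a - (+ 2) * e) * 1ℤ
    certificate = solve-∀

  -- The hypotheses of Lemma 7 in the doubled form used by `Comparison`, where
  -- twiceEdges k a = 2e, twiceEdges L i = 2x, e + x = N and 2N = v(v-1).
  module Doubled (k a L i e x N v : ℤ) (edges-e : twiceEdges k a ≡ (+ 2) * e)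
    (edges-x : twiceEdges L i ≡ (+ 2) * x) (e+x≡N : e + x ≡ N) (choose2 : (+ 2) * N + v ≡ v * v) where

    edges : twiceEdges k a + twiceEdges L i ≡ v * (v - 1ℤ)
    edges = vanish _ _ (i≡j⇒i-j≡0 choose2) (vanish _ _ (i≡j⇒i-j≡0 e+x≡N) (vanish _ _ (i≡j⇒i-j≡0 edges-e)
      (vanish _ _ (i≡j⇒i-j≡0 edges-x) (certificate k a L i e x N v))))
      where
      certificate : ∀ (k a L i e x N v : ℤ) →
        k * (k - 1ℤ) + (+ 2) * a + (L * (L - 1ℤ) + (+ 2) * i)
        ≡ v * (v - 1ℤ) + ((+ 2) * N + v - v * v) * 1ℤ + (e + x - N) * (+ 2)
          + (k * (k - 1ℤ) + (+ 2) * a - (+ 2) * e) * 1ℤ + (L * (L - 1ℤ) + (+ 2) * i - (+ 2) * x) * 1ℤ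
      certificate = solve-∀

    lower : v ≤ e → (+ 2) * v ≤ twiceEdges k a
    lower v≤e = subst ((+ 2) * v ≤_) (sym edges-e) (*-monoˡ-≤-nonNeg (+ 2) v≤e)

    upper : (+ 20) * e + (+ 11) * v ≤ (+ 10) * N → (+ 10) * twiceEdges k a + (+ 11) * v ≤ (+ 5) * (v * (v - 1ℤ))
    upper = subst₂ _≤_ (sym (trans (cong (λ t → (+ 10) * t + (+ 11) * v) edges-e) (double e v)))
      (vanish _ _ (i≡j⇒i-j≡0 choose2) (quintuple N v))
      where
      double : ∀ e v → (+ 10) * ((+ 2) * e) + (+ 11) * v ≡ (+ 20) * e + (+ 11) * v
      double = solve-∀
      quintuple : ∀ N v → (+ 10) * N ≡ (+ 5) * (v * (v - 1ℤ)) + ((+ 2) * N + v - v * v) * (+ 5)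
      quintuple = solve-∀

module Counting where

  open import Data.Nat using (ℕ; zero; suc; _+_; _*_; _∸_; _<ᵇ_; _≡ᵇ_; _≤_; _<_; z≤n; s≤s)
  open import Data.Nat.Properties
  open import Data.Nat.Combinatorics using (_C_; nC1≡n; nCk+nC[k+1]≡[n+1]C[k+1])
  open import Data.Nat.ListAction using (sum)
  open import Data.Nat.Tactic.RingSolver using (solve-∀)
  open import Data.Bool using (Bool; true; false; _∧_; _∨_; not; T)
  open import Data.Bool.Properties using (T?; ∧-zeroʳ; ∧-identityʳ; ∨-identityʳ)
  open import Data.Unit using (tt)
  open import Data.Empty using (⊥-elim)
  open import Data.Fin using (Fin; toℕ) renaming (zero to fzero; suc to fsuc)
  open import Data.List using ([]; _∷_; map; filter; length; allFin; tabulate; applyUpTo)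
  open import Data.List.Properties using (map-tabulate)
  open import Data.Product using (_×_; _,_; proj₁; proj₂)
  open import Function using (_∘_)
  open import Algebra.Properties.CommutativeSemigroup +-commutativeSemigroup using (interchange)
  open import Relation.Binary.PropositionalEquality

  bit : Bool → ℕ
  bit true = 1
  bit false = 0

  Σ< : ℕ → (ℕ → ℕ) → ℕ
  Σ< n f = sum (applyUpTo f n)

  count : ℕ → (ℕ → Bool) → ℕ
  count n P = Σ< n (bit ∘ P)

  Σ<-+ : ∀ m n f → Σ< (m + n) f ≡ Σ< m f + Σ< n (λ y → f (m + y))
  Σ<-+ zero n f = refl
  Σ<-+ (suc m) n f = trans (cong (f 0 +_) (Σ<-+ m n (f ∘ suc))) (sym (+-assoc (f 0) _ _))

  Σ<-cong : ∀ n {f g : ℕ → ℕ} → (∀ y → y < n → f y ≡ g y) → Σ< n f ≡ Σ< n g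
  Σ<-cong zero eq = refl
  Σ<-cong (suc n) eq = cong₂ _+_ (eq 0 (s≤s z≤n)) (Σ<-cong n (λ y y<n → eq (suc y) (s≤s y<n)))

  Σ<-const : ∀ n c {f : ℕ → ℕ} → (∀ y → y < n → f y ≡ c) → Σ< n f ≡ n * c
  Σ<-const zero c eq = refl
  Σ<-const (suc n) c eq = cong₂ _+_ (eq 0 (s≤s z≤n)) (Σ<-const n c (λ y y<n → eq (suc y) (s≤s y<n)))

  Σ<-blocks : ∀ {n a b} (f : ℕ → ℕ) {c₁ c₂ c₃ c₄} → a ≤ b → b < n →
    (∀ x → x < a → f x ≡ c₁) → (∀ x → a ≤ x → x < b → f x ≡ c₂) → f b ≡ c₃ → (∀ x → b < x → f x ≡ c₄) →
    Σ< n f ≡ a * c₁ + (b ∸ a) * c₂ + c₃ + (n ∸ suc b) * c₄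
  Σ<-blocks {n} {a} {b} f {c₁} {c₂} {c₃} {c₄} a≤b b<n low mid apex high = begin
    Σ< n f
      ≡⟨ cong (λ l → Σ< l f) n≡a+[m+1+r] ⟩
    Σ< (a + (m + suc r)) f
      ≡⟨ Σ<-+ a (m + suc r) f ⟩
    Σ< a f + Σ< (m + suc r) (λ y → f (a + y))
      ≡⟨ cong (Σ< a f +_) (Σ<-+ m (suc r) _) ⟩
    Σ< a f + (Σ< m (λ y → f (a + y)) + (f (a + (m + 0)) + Σ< r (λ y → f (a + (m + suc y)))))
      ≡⟨ cong₂ _+_ (Σ<-const a c₁ low)
           (cong₂ _+_ (Σ<-const m c₂ mid′) (cong₂ _+_ apex′ (Σ<-const r c₄ high′))) ⟩
    a * c₁ + (m * c₂ + (c₃ + r * c₄))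
      ≡⟨ sym (trans (+-assoc (a * c₁ + m * c₂) c₃ _) (+-assoc (a * c₁) _ _)) ⟩
    a * c₁ + m * c₂ + c₃ + r * c₄ ∎
    where
    open ≡-Reasoning
    m = b ∸ a
    r = n ∸ suc b
    a+m≡b : a + m ≡ b
    a+m≡b = m+[n∸m]≡n a≤b
    a+[m+y]≡b+y : ∀ y → a + (m + y) ≡ b + y
    a+[m+y]≡b+y y = trans (sym (+-assoc a m y)) (cong (_+ y) a+m≡b)
    n≡a+[m+1+r] : n ≡ a + (m + suc r)
    n≡a+[m+1+r] = sym (trans (a+[m+y]≡b+y (suc r)) (trans (+-suc b r) (m+[n∸m]≡n b<n)))
    mid′ : ∀ y → y < m → f (a + y) ≡ c₂
    mid′ y y<m = mid (a + y) (m≤m+n a y) (subst (a + y <_) a+m≡b (+-monoʳ-< a y<m))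
    apex′ : f (a + (m + 0)) ≡ c₃
    apex′ = trans (cong f (trans (a+[m+y]≡b+y 0) (+-identityʳ b))) apex
    high′ : ∀ y → y < r → f (a + (m + suc y)) ≡ c₄
    high′ y _ = high _ (subst (b <_) (sym (a+[m+y]≡b+y (suc y))) (m<m+n b (s≤s z≤n)))

  <ᵇ-true : ∀ {m n} → m < n → (m <ᵇ n) ≡ true
  <ᵇ-true {zero} {suc n} _ = refl
  <ᵇ-true {suc m} {suc n} (s≤s m<n) = <ᵇ-true m<n

  <ᵇ-false : ∀ {m n} → n ≤ m → (m <ᵇ n) ≡ false
  <ᵇ-false {m} {zero} _ = refl
  <ᵇ-false {suc m} {suc n} (s≤s n≤m) = <ᵇ-false n≤m

  ≡ᵇ-refl : ∀ m → (m ≡ᵇ m) ≡ true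
  ≡ᵇ-refl zero = refl
  ≡ᵇ-refl (suc m) = ≡ᵇ-refl m

  ≡ᵇ-false : ∀ {m n} → m ≢ n → (m ≡ᵇ n) ≡ false
  ≡ᵇ-false {m} {n} m≢n with m ≡ᵇ n in eq
  ... | true = ⊥-elim (m≢n (≡ᵇ⇒≡ m n (subst T (sym eq) tt)))
  ... | false = refl

  <ᵇ-or-≡ᵇ : ∀ y k → ((y <ᵇ k) ∨ (y ≡ᵇ k)) ≡ (y <ᵇ suc k)
  <ᵇ-or-≡ᵇ zero zero = refl
  <ᵇ-or-≡ᵇ zero (suc k) = refl
  <ᵇ-or-≡ᵇ (suc y) zero = refl
  <ᵇ-or-≡ᵇ (suc y) (suc k) = <ᵇ-or-≡ᵇ y k

  count-cong : ∀ n {P Q : ℕ → Bool} → (∀ y → y < n → P y ≡ Q y) → count n P ≡ count n Q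
  count-cong n eq = Σ<-cong n (λ y y<n → cong bit (eq y y<n))

  count-false : ∀ n → count n (λ _ → false) ≡ 0
  count-false n = trans (Σ<-const n 0 (λ _ _ → refl)) (*-zeroʳ n)

  count-below : ∀ n m → m ≤ n → count n (λ y → y <ᵇ m) ≡ m
  count-below n zero _ = count-false n
  count-below (suc n) (suc m) (s≤s m≤n) = cong suc (count-below n m m≤n)

  count-below-except : ∀ n m x → x < m → m ≤ n → count n (λ y → not (x ≡ᵇ y) ∧ (y <ᵇ m)) ≡ m ∸ 1
  count-below-except (suc n) (suc m) zero _ (s≤s m≤n) = count-below n m m≤n
  count-below-except (suc n) (suc (suc m)) (suc x) (s≤s x<m) (s≤s m≤n) =
    cong suc (count-below-except n (suc m) x x<m m≤n)

  count-below-outside : ∀ n m x → m ≤ x → m ≤ n → count n (λ y → not (x ≡ᵇ y) ∧ (y <ᵇ m)) ≡ m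
  count-below-outside n zero x _ _ = trans (count-cong n (λ y _ → ∧-zeroʳ (not (x ≡ᵇ y)))) (count-false n)
  count-below-outside (suc n) (suc m) (suc x) (s≤s m≤x) (s≤s m≤n) = cong suc (count-below-outside n m x m≤x m≤n)

  count-except : ∀ n x → x < n → count n (λ y → not (x ≡ᵇ y)) ≡ n ∸ 1
  count-except n x x<n = trans (count-cong n below-n) (count-below-except n n x x<n ≤-refl)
    where
    below-n : ∀ y → y < n → not (x ≡ᵇ y) ≡ not (x ≡ᵇ y) ∧ (y <ᵇ n)
    below-n y y<n = sym (trans (cong (not (x ≡ᵇ y) ∧_) (<ᵇ-true y<n)) (∧-identityʳ _))

  count-+ : ∀ n (P Q R : ℕ → Bool) → (∀ y → bit (P y) + bit (Q y) ≡ bit (R y)) →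
    count n P + count n Q ≡ count n R
  count-+ zero P Q R eq = refl
  count-+ (suc n) P Q R eq = trans (interchange (bit (P 0)) _ (bit (Q 0)) _)
    (cong₂ _+_ (eq 0) (count-+ n (P ∘ suc) (Q ∘ suc) (R ∘ suc) (eq ∘ suc)))

  sum-tabulate : ∀ n (F : Fin n → ℕ) (f : ℕ → ℕ) → (∀ x → F x ≡ f (toℕ x)) → sum (tabulate F) ≡ Σ< n f
  sum-tabulate zero F f eq = refl
  sum-tabulate (suc n) F f eq = cong₂ _+_ (eq fzero) (sum-tabulate n (F ∘ fsuc) (f ∘ suc) (eq ∘ fsuc))

  length-filter : ∀ {A : Set} (P : A → Bool) xs → length (filter (λ x → T? (P x)) xs) ≡ sum (map (bit ∘ P) xs)
  length-filter P [] = refl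
  length-filter P (x ∷ xs) with P x
  ... | true = cong suc (length-filter P xs)
  ... | false = length-filter P xs

  onFin : (v : ℕ) → (ℕ → ℕ → Bool) → Fin v → Fin v → Bool
  onFin v A x y = A (toℕ x) (toℕ y)

  degree-count : ∀ v A (x : Fin v) → degree (onFin v A) x ≡ count v (A (toℕ x))
  degree-count v A x = begin
    length (filter (λ y → T? (A (toℕ x) (toℕ y))) (allFin v))
      ≡⟨ length-filter _ (allFin v) ⟩
    sum (map (bit ∘ A (toℕ x) ∘ toℕ) (allFin v))
      ≡⟨ cong sum (map-tabulate {n = v} (λ y → y) _) ⟩
    sum (tabulate {n = v} (bit ∘ A (toℕ x) ∘ toℕ))
      ≡⟨ sum-tabulate v _ _ (λ _ → refl) ⟩
    count v (A (toℕ x)) ∎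
    where open ≡-Reasoning

  sumSqDeg-count : ∀ v A → sumSqDeg (onFin v A) ≡ Σ< v (λ x → count v (A x) * count v (A x))
  sumSqDeg-count v A = trans (cong sum (map-tabulate {n = v} (λ y → y) _))
    (sum-tabulate v _ _ (λ x → cong (λ d → d * d) (degree-count v A x)))

  qcAdj-low : ∀ k j x y → x < k ∸ j → qcAdj k j x y ≡ not (x ≡ᵇ y) ∧ (y <ᵇ suc k)
  qcAdj-low k j x y x<a
    rewrite <ᵇ-true (<-≤-trans x<a (m∸n≤m k j)) | ≡ᵇ-false (<⇒≢ (<-≤-trans x<a (m∸n≤m k j)))
          | <ᵇ-true x<a | ∧-identityʳ (y ≡ᵇ k) | <ᵇ-or-≡ᵇ y k = refl

  qcAdj-mid : ∀ k j x y → k ∸ j ≤ x → x < k → qcAdj k j x y ≡ not (x ≡ᵇ y) ∧ (y <ᵇ k)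
  qcAdj-mid k j x y a≤x x<k
    rewrite <ᵇ-true x<k | ≡ᵇ-false (<⇒≢ x<k) | <ᵇ-false a≤x
          | ∧-zeroʳ (y ≡ᵇ k) | ∨-identityʳ (y <ᵇ k) = refl

  qcAdj-apex : ∀ k j y → qcAdj k j k y ≡ not (k ≡ᵇ y) ∧ (y <ᵇ (k ∸ j))
  qcAdj-apex k j y
    rewrite <ᵇ-false (≤-refl {k}) | ≡ᵇ-refl k | <ᵇ-false (m∸n≤m k j)
          | ∧-zeroʳ (y ≡ᵇ k) | ∨-identityʳ (y <ᵇ (k ∸ j)) = refl

  qcAdj-high : ∀ k j x y → k < x → qcAdj k j x y ≡ false
  qcAdj-high k j x y k<x
    rewrite <ᵇ-false (<⇒≤ k<x) | ≡ᵇ-false (>⇒≢ k<x) | <ᵇ-false (≤-trans (m∸n≤m k j) (<⇒≤ k<x))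
          | ∧-zeroʳ (y ≡ᵇ k) | ∧-zeroʳ (not (x ≡ᵇ y)) = refl

  module _ {n k : ℕ} (j : ℕ) (k<n : k < n) where

    qc-degree-low : ∀ {x} → x < k ∸ j → count n (qcAdj k j x) ≡ k
    qc-degree-low {x} x<a = trans (count-cong n (λ y _ → qcAdj-low k j x y x<a))
      (count-below-except n (suc k) x (m<n⇒m<1+n (<-≤-trans x<a (m∸n≤m k j))) k<n)

    qc-degree-mid : ∀ {x} → k ∸ j ≤ x → x < k → count n (qcAdj k j x) ≡ k ∸ 1
    qc-degree-mid {x} a≤x x<k = trans (count-cong n (λ y _ → qcAdj-mid k j x y a≤x x<k))
      (count-below-except n k x x<k (<⇒≤ k<n))

    qc-degree-apex : count n (qcAdj k j k) ≡ k ∸ j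
    qc-degree-apex = trans (count-cong n (λ y _ → qcAdj-apex k j y))
      (count-below-outside n (k ∸ j) k (m∸n≤m k j) (≤-trans (m∸n≤m k j) (<⇒≤ k<n)))

    qc-degree-high : ∀ {x} → k < x → count n (qcAdj k j x) ≡ 0
    qc-degree-high {x} k<x = trans (count-cong n (λ y _ → qcAdj-high k j x y k<x)) (count-false n)

  profileℕ : (ℕ → ℕ) → ℕ → ℕ → ℕ → ℕ
  profileℕ g v k a = a * g k + (k ∸ a) * g (k ∸ 1) + g a + (v ∸ suc k) * g 0

  qc-profile : ∀ {v k} j → k < v → (g : ℕ → ℕ) →
    Σ< v (λ x → g (count v (qcAdj k j x))) ≡ profileℕ g v k (k ∸ j)
  qc-profile {v} {k} j k<v g = Σ<-blocks _ (m∸n≤m k j) k<v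
    (λ _ x<a → cong g (qc-degree-low j k<v x<a))
    (λ _ a≤x x<k → cong g (qc-degree-mid j k<v a≤x x<k))
    (cong g (qc-degree-apex j k<v))
    (λ _ k<x → cong g (qc-degree-high j k<v k<x))

  -- Each y is adjacent to x in exactly one of a loopless graph and its complement.
  complement-bit : ∀ c b → bit (not c ∧ not (not c ∧ b)) + bit (not c ∧ b) ≡ bit (not c)
  complement-bit true b = refl
  complement-bit false true = refl
  complement-bit false false = refl

  qc-complement-degree : ∀ v k j x → x < v →
    count v (λ y → not (x ≡ᵇ y) ∧ not (qcAdj k j x y)) ≡ (v ∸ 1) ∸ count v (qcAdj k j x)
  qc-complement-degree v k j x x<v = begin
    count v S                          ≡⟨ sym (m+n∸n≡m (count v S) (count v (qcAdj k j x))) ⟩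
    count v S + count v (qcAdj k j x) ∸ count v (qcAdj k j x)
      ≡⟨ cong (_∸ count v (qcAdj k j x)) (count-+ v _ _ _ (λ y → complement-bit (x ≡ᵇ y) _)) ⟩
    count v (λ y → not (x ≡ᵇ y)) ∸ count v (qcAdj k j x)
      ≡⟨ cong (_∸ count v (qcAdj k j x)) (count-except v x x<v) ⟩
    (v ∸ 1) ∸ count v (qcAdj k j x) ∎
    where
    open ≡-Reasoning
    S : ℕ → Bool
    S y = not (x ≡ᵇ y) ∧ not (qcAdj k j x y)

  -- rep e = (k , j) represents e = C(k+1,2) - j with 1 ≤ j ≤ k (doubled to stay in ℕ).
  Represents : ℕ → ℕ × ℕ → Set
  Represents e kj = 1 ≤ proj₂ kj × proj₂ kj ≤ proj₁ kj × 2 * e + 2 * proj₂ kj ≡ proj₁ kj * suc (proj₁ kj)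

  rep-spec : ∀ e → Represents e (rep e)
  rep-spec zero = s≤s z≤n , s≤s z≤n , refl
  rep-spec (suc e) with rep e | rep-spec e
  ... | k , suc zero | _ , _ , eq =
    s≤s z≤n , ≤-refl , trans (regroup k e) (trans (cong (_+ 2 * suc k) eq) (next-clique k))
    where
    regroup : ∀ k e → 2 * suc e + 2 * suc k ≡ (2 * e + 2 * 1) + 2 * suc k
    regroup = solve-∀
    next-clique : ∀ k → k * suc k + 2 * suc k ≡ suc k * suc (suc k)
    next-clique = solve-∀
  ... | k , suc (suc j) | _ , j≤k , eq = s≤s z≤n , ≤-trans (n≤1+n _) j≤k , trans (shift e j) eq
    where
    shift : ∀ e j → 2 * suc e + 2 * suc j ≡ 2 * e + 2 * suc (suc j)
    shift = solve-∀

  -- In the paper's notation e = C(k,2) + a with 0 ≤ a < k: the quasi-complete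
  -- graph is K_k plus a vertex joined to a vertices of the clique.
  clique : ℕ → ℕ
  clique e = proj₁ (rep e)

  attached : ℕ → ℕ
  attached e = proj₁ (rep e) ∸ proj₂ (rep e)

  attached<clique : ∀ e → attached e < clique e
  attached<clique e with rep-spec e
  ... | 1≤j , j≤k , _ = ∸-monoʳ-< 1≤j j≤k

  twice-choose2 : ∀ v → 2 * (v C 2) + v ≡ v * v
  twice-choose2 zero = refl
  twice-choose2 (suc v) = begin
    2 * (suc v C 2) + suc v    ≡⟨ cong (λ c → 2 * c + suc v) pascal ⟩
    2 * (v + v C 2) + suc v    ≡⟨ regroup v (v C 2) ⟩
    (2 * (v C 2) + v) + (2 * v + 1) ≡⟨ cong (_+ (2 * v + 1)) (twice-choose2 v) ⟩
    v * v + (2 * v + 1)        ≡⟨ square-suc v ⟩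
    suc v * suc v ∎
    where
    open ≡-Reasoning
    pascal : suc v C 2 ≡ v + v C 2
    pascal = sym (trans (cong (_+ v C 2) (sym (nC1≡n v))) (nCk+nC[k+1]≡[n+1]C[k+1] v 1))
    regroup : ∀ v c → 2 * (v + c) + suc v ≡ (2 * c + v) + (2 * v + 1)
    regroup = solve-∀
    square-suc : ∀ v → v * v + (2 * v + 1) ≡ suc v * suc v
    square-suc = solve-∀

  -- The upper bound of Lemma 7 gives e < C(v,2): 20e < 20e + 11v ≤ 10C(v,2) ≤ 20C(v,2).
  below-choose2 : ∀ v e → 1 ≤ v → 20 * e + 11 * v ≤ 10 * (v C 2) → e < v C 2
  below-choose2 v e 1≤v upper = *-cancelˡ-< 20 e (v C 2)
    (<-≤-trans (m<m+n (20 * e) {11 * v} (≤-trans 1≤v (m≤m+n v (10 * v))))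
               (≤-trans upper (*-monoˡ-≤ (v C 2) (m≤m+n 10 10))))

  Csq-profile : ∀ v e → clique e < v → Csq v e ≡ profileℕ (λ d → d * d) v (clique e) (attached e)
  Csq-profile v e k<v = trans (sumSqDeg-count v _) (qc-profile (proj₂ (rep e)) k<v (λ d → d * d))

  Ssq-profile : ∀ v e → let x = v C 2 ∸ e in clique x < v →
    Ssq v e ≡ profileℕ (λ d → ((v ∸ 1) ∸ d) * ((v ∸ 1) ∸ d)) v (clique x) (attached x)
  Ssq-profile v e L<v = trans (sumSqDeg-count v (λ y z → not (y ≡ᵇ z) ∧ not (qcAdj L j y z))) (trans
    (Σ<-cong v (λ y y<v → cong (λ d → d * d) (qc-complement-degree v L j y y<v)))
    (qc-profile j L<v (λ d → ((v ∸ 1) ∸ d) * ((v ∸ 1) ∸ d))))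
    where
    L j : ℕ
    L = proj₁ (rep (v C 2 ∸ e))
    j = proj₂ (rep (v C 2 ∸ e))

module Casting where

  open IntegerCertificates using (degreeProfile; square; twiceEdges)
  open Counting using (profileℕ; clique; attached; attached<clique; rep-spec; twice-choose2; Csq-profile; Ssq-profile)
  open import Data.Nat as ℕ using (ℕ; suc; z≤n; s≤s)
  import Data.Nat.Properties as ℕ
  open import Data.Nat.Combinatorics using (_C_)
  open import Data.Integer using (ℤ; +_; 1ℤ; _+_; _-_; _*_)
  open import Data.Integer.Properties using (pos-+; pos-*; m-n≡m⊖n; ⊖-≥)
  open import Data.Integer.Tactic.RingSolver using (solve-∀)
  open import Data.Product using (proj₁; proj₂)
  open import Relation.Binary.PropositionalEquality

  <⇒≤∸1 : ∀ {m n} → m ℕ.< n → m ℕ.≤ n ℕ.∸ 1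
  <⇒≤∸1 (s≤s m≤n) = m≤n

  pos-∸ : ∀ {m n} → n ℕ.≤ m → + (m ℕ.∸ n) ≡ + m - + n
  pos-∸ {m} {n} n≤m = sym (trans (m-n≡m⊖n m n) (⊖-≥ n≤m))

  cast-+ : ∀ {m n x y} → + m ≡ x → + n ≡ y → + (m ℕ.+ n) ≡ x + y
  cast-+ {m} {n} p q = trans (pos-+ m n) (cong₂ _+_ p q)

  cast-* : ∀ {m n x y} → + m ≡ x → + n ≡ y → + (m ℕ.* n) ≡ x * y
  cast-* {m} {n} p q = trans (pos-* m n) (cong₂ _*_ p q)

  profile-cast : ∀ {v k a} (g : ℕ → ℕ) (G : ℤ → ℤ) → a ℕ.< k → k ℕ.< v →
    (∀ t → t ℕ.< v → + g t ≡ G (+ t)) → + profileℕ g v k a ≡ degreeProfile G (+ v) (+ k) (+ a)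
  profile-cast {v} {k} {a} g G a<k k<v gG =
    cast-+ (cast-+ (cast-+ (cast-* {a} refl (gG k k<v)) (cast-* (pos-∸ (ℕ.<⇒≤ a<k)) degree-k-1))
                   (gG a (ℕ.<-trans a<k k<v)))
           (cast-* isolated (gG 0 (ℕ.≤-trans (s≤s z≤n) k<v)))
    where
    degree-k-1 : + g (k ℕ.∸ 1) ≡ G (+ k - 1ℤ)
    degree-k-1 = trans (gG (k ℕ.∸ 1) (ℕ.≤-<-trans (ℕ.m∸n≤m k 1) k<v)) (cong G (pos-∸ (ℕ.≤-trans (s≤s z≤n) a<k)))
    minus-suc : ∀ x y → x - (1ℤ + y) ≡ x - 1ℤ - y
    minus-suc = solve-∀
    isolated : + (v ℕ.∸ suc k) ≡ + v - 1ℤ - + k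
    isolated = trans (pos-∸ k<v) (minus-suc (+ v) (+ k))

  C-value : ∀ v e → clique e ℕ.< v → + Csq v e ≡ degreeProfile square (+ v) (+ clique e) (+ attached e)
  C-value v e k<v = trans (cong +_ (Csq-profile v e k<v))
    (profile-cast (λ d → d ℕ.* d) square (attached<clique e) k<v (λ t _ → pos-* t t))

  S-value : ∀ v e → let x = v C 2 ℕ.∸ e in clique x ℕ.< v →
    + Ssq v e ≡ degreeProfile (λ t → square (+ v - 1ℤ - t)) (+ v) (+ clique x) (+ attached x)
  S-value v e L<v = trans (cong +_ (Ssq-profile v e L<v))
    (profile-cast (λ d → ((v ℕ.∸ 1) ℕ.∸ d) ℕ.* ((v ℕ.∸ 1) ℕ.∸ d)) (λ t → square (+ v - 1ℤ - t))
      (attached<clique (v C 2 ℕ.∸ e)) L<v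
      (λ t t<v → cast-* (complement t t<v) (complement t t<v)))
    where
    complement : ∀ t → t ℕ.< v → + ((v ℕ.∸ 1) ℕ.∸ t) ≡ + v - 1ℤ - + t
    complement t t<v = trans (pos-∸ (<⇒≤∸1 t<v)) (cong (_- + t) (pos-∸ (ℕ.≤-trans (s≤s z≤n) t<v)))

  twice-choose2ℤ : ∀ v → (+ 2) * + (v C 2) + + v ≡ + v * + v
  twice-choose2ℤ v = trans (sym (cast-+ (pos-* 2 (v C 2)) refl)) (trans (cong +_ (twice-choose2 v)) (pos-* v v))

  twiceEdges-rep : ∀ e → twiceEdges (+ clique e) (+ attached e) ≡ (+ 2) * + e
  twiceEdges-rep e = begin
    twiceEdges (+ k) (+ (k ℕ.∸ j))     ≡⟨ cong (twiceEdges (+ k)) (pos-∸ j≤k) ⟩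
    twiceEdges (+ k) (+ k - + j)       ≡⟨ unfold (+ k) (+ j) ⟩
    + k * (1ℤ + + k) - (+ 2) * + j     ≡⟨ cong (_- (+ 2) * + j) (sym spec) ⟩
    (+ 2) * + e + (+ 2) * + j - (+ 2) * + j ≡⟨ cancel (+ e) (+ j) ⟩
    (+ 2) * + e ∎
    where
    open ≡-Reasoning
    k j : ℕ
    k = clique e
    j = proj₂ (rep e)
    j≤k : j ℕ.≤ k
    j≤k = proj₁ (proj₂ (rep-spec e))
    spec : (+ 2) * + e + (+ 2) * + j ≡ + k * (1ℤ + + k)
    spec = trans (sym (cast-+ (pos-* 2 e) (pos-* 2 j))) (trans (cong +_ (proj₂ (proj₂ (rep-spec e)))) (pos-* k (suc k)))
    unfold : ∀ k j → k * (k - 1ℤ) + (+ 2) * (k - j) ≡ k * (1ℤ + k) - (+ 2) * j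
    unfold = solve-∀
    cancel : ∀ e j → (+ 2) * e + (+ 2) * j - (+ 2) * j ≡ (+ 2) * e
    cancel = solve-∀

open import Data.Nat using (ℕ; _+_; _*_; _∸_; _≤_; _<_; z≤n; s≤s)
open import Data.Nat.Properties using (≤-trans; m+[n∸m]≡n; <⇒≤; ∸-monoʳ-<)
open import Data.Nat.Combinatorics using (_C_)
import Data.Integer as ℤ
open import Data.Integer using (+_; +≤+; 1ℤ)
open import Data.Integer.Properties using (pos-+; pos-*; drop‿+≤+)
open import Relation.Binary.PropositionalEquality using (sym; trans; cong; subst₂)
open IntegerCertificates using (module Comparison; module Doubled; clique-fits; degreeProfile; square)
open Counting using (clique; attached; attached<clique; below-choose2)
open Casting using (cast-+; C-value; S-value; twiceEdges-rep; twice-choose2ℤ)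

lemma7 : (v e : ℕ) → 5 ≤ v → v ≤ e → 20 * e + 11 * v ≤ 10 * (v C 2) →
    Csq v e < Ssq v e
lemma7 v e 5≤v v≤e upper =
  drop‿+≤+ (subst₂ ℤ._≤_ (cong (λ c → 1ℤ ℤ.+ c) (sym (C-value v e (drop‿+≤+ k<v))))
                         (sym (S-value v e (drop‿+≤+ L<v))) S>C)
  where
  N x : ℕ
  N = v C 2
  x = N ∸ e
  1≤v : 1 ≤ v
  1≤v = ≤-trans (s≤s z≤n) 5≤v
  e<N : e < N
  e<N = below-choose2 v e 1≤v upper
  x<N : x < N
  x<N = ∸-monoʳ-< (≤-trans 1≤v v≤e) (<⇒≤ e<N)
  k<v : 1ℤ ℤ.+ + clique e ℤ.≤ + v
  k<v = clique-fits (+ clique e) (+ attached e) (+≤+ z≤n) (twiceEdges-rep e) (twice-choose2ℤ v) (+≤+ e<N) (+≤+ 1≤v)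
  L<v : 1ℤ ℤ.+ + clique x ℤ.≤ + v
  L<v = clique-fits (+ clique x) (+ attached x) (+≤+ z≤n) (twiceEdges-rep x) (twice-choose2ℤ v) (+≤+ x<N) (+≤+ 1≤v)
  module D = Doubled (+ clique e) (+ attached e) (+ clique x) (+ attached x) (+ e) (+ x) (+ N) (+ v)
    (twiceEdges-rep e) (twiceEdges-rep x) (trans (sym (pos-+ e x)) (cong +_ (m+[n∸m]≡n (<⇒≤ e<N)))) (twice-choose2ℤ v)
  S>C : 1ℤ ℤ.+ degreeProfile square (+ v) (+ clique e) (+ attached e)
        ℤ.≤ degreeProfile (λ t → square (+ v ℤ.- 1ℤ ℤ.- t)) (+ v) (+ clique x) (+ attached x)
  S>C = Comparison.S>C (+ clique e) (+ attached e) (+ clique x) (+ attached x) (+ v)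
    (+≤+ z≤n) (+≤+ (attached<clique e)) (+≤+ z≤n) (+≤+ (attached<clique x)) k<v L<v
    D.edges (D.lower (+≤+ v≤e)) (D.upper (subst₂ ℤ._≤_ (cast-+ (pos-* 20 e) (pos-* 11 v)) (pos-* 10 N) (+≤+ upper)))
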